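{- Let $v,w\in\mathcal{P}$ and suppose $v$ is a factor of $w$. Then the permutation $\psi^\circ_w$ contains the permutation $\psi^\circ_v$, and the permutation $\psi^\bullet_w$ contains the permutation $\psi^\bullet_v$.
   Context: Permutations are in one-line notation; $\pi$ contains $\sigma$ if $\pi$ has a subsequence order-isomorphic to $\sigma$. A finite set of points in the plane with distinct $x$- and $y$-coordinates is order-isomorphic to a unique permutation (read $y$-ranks from left to right). A factor of a word is a contiguous subword. Words are over the alphabet $\{\mathsf{u},\mathsf{d},\mathsf{r_u},\mathsf{r_d}\}$. Let $\rho:\{0,1\}^*\to\{\mathsf{u},\mathsf{d},\mathsf{r_u},\mathsf{r_d}\}^*$ be the morphism $0\mapsto\mathsf{d}\mathsf{r_d}$, $1\mapsto\mathsf{u}\mathsf{r_u}$, and let $\mathcal{P}$ be the set of all factors (including the empty word $\varepsilon$) of words $\rho(x)$, $x\in\{0,1\}^*$. For $w=w(1)\cdots w(n)\in\mathcal{P}$ define points $p_0,p_1,\dots,p_n$ with distinct coordinates: $p_0$ (the origin) is arbitrary; $p_1$ lies to the right of and above $p_0$ if $w(1)\in\{\mathsf{u},\mathsf{r_u}\}$, and to the right of and below $p_0$ if $w(1)\in\{\mathsf{d},\mathsf{r_d}\}$; for $i\ge2$, $p_i$ lies outside the rectangular hull (smallest axis-parallel rectangle containing) of $\{p_0,\dots,p_{i-1}\}$ and lies horizontally or vertically between $p_{i-1}$ and the rectangular hull of $\{p_0,\dots,p_{i-2}\}$, positioned above that hull if $w(i)=\mathsf{u}$, below it if $w(i)=\mathsf{d}$,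 and to its right if $w(i)\in\{\mathsf{r_u},\mathsf{r_d}\}$. (The resulting relative order of the points depends only on $w$.) Then $\psi^\circ_w$ is the permutation order-isomorphic to $\{p_1,\dots,p_n\}$ and $\psi^\bullet_w$ the permutation order-isomorphic to $\{p_0,p_1,\dots,p_n\}$. -}

module Defs where

open import Data.Bool using (Bool; true; false)
open import Data.Nat as ℕ using (ℕ; zero; suc)
open import Data.Integer as ℤ using (ℤ; +_; _⊓_; _⊔_)
open import Data.Fin using (Fin; cast)
open import Data.List using (List; []; _∷_; _++_; length; concatMap; applyUpTo; upTo; zip; foldr; lookup; drop)
open import Data.List.Relation.Binary.Permutation.Propositional using (_↭_)
open import Data.List.Relation.Binary.Sublist.Propositional using (_⊆_)
open import Data.List.Relation.Unary.AllPairs using (AllPairs)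
open import Data.Product using (Σ; ∃; _×_; _,_; proj₁; proj₂)
open import Data.Sum using (_⊎_)
open import Data.Unit using (⊤)
open import Data.Empty using (⊥)
open import Function.Bundles using (_⇔_)
open import Function.Definitions using (Bijective)
open import Relation.Binary.PropositionalEquality using (_≡_; _≢_)
open import Relation.Nullary using (¬_)

data Letter : Set where
  u d rᵤ r_d : Letter

Word : Set
Word = List Letter

ρ₁ : Bool → Word
ρ₁ false = d ∷ r_d ∷ []
ρ₁ true  = u ∷ rᵤ ∷ []

ρ : List Bool → Word
ρ = concatMap ρ₁

Factor : {A : Set} → List A → List A → Set
Factor v w = Σ _ λ pre → Σ _ λ suf → pre ++ v ++ suf ≡ w

In𝒫 : Word → Set
In𝒫 w = Σ (List Bool) λ x → Factor w (ρ x)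

-- Points in the plane (integer coordinates suffice for order types)

Point : Set
Point = ℤ × ℤ

X Y : Point → ℤ
X = proj₁
Y = proj₂

minX maxX minY maxY : Point → List Point → ℤ
minX q qs = foldr (λ p m → X p ⊓ m) (X q) qs
maxX q qs = foldr (λ p m → X p ⊔ m) (X q) qs
minY q qs = foldr (λ p m → Y p ⊓ m) (Y q) qs
maxY q qs = foldr (λ p m → Y p ⊔ m) (Y q) qs

InHull : Point → Point → List Point → Set
InHull p q qs = (minX q qs ℤ.≤ X p × X p ℤ.≤ maxX q qs)
              × (minY q qs ℤ.≤ Y p × Y p ℤ.≤ maxY q qs)

BetweenPtInt : ℤ → ℤ → ℤ → ℤ → Set
BetweenPtInt a b lo hi = (hi ℤ.< a × a ℤ.< b) ⊎ (b ℤ.< a × a ℤ.< lo)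

FirstStep : Letter → Point → Point → Set
FirstStep u   p₁ p₀ = X p₀ ℤ.< X p₁ × Y p₀ ℤ.< Y p₁
FirstStep rᵤ  p₁ p₀ = X p₀ ℤ.< X p₁ × Y p₀ ℤ.< Y p₁
FirstStep d   p₁ p₀ = X p₀ ℤ.< X p₁ × Y p₁ ℤ.< Y p₀
FirstStep r_d p₁ p₀ = X p₀ ℤ.< X p₁ × Y p₁ ℤ.< Y p₀

-- step i ≥ 2: new point pᵢ, previous point pᵢ₋₁ = p, and
-- older points p₀,…,pᵢ₋₂ given (in any order) as the nonempty list q ∷ qs.
-- H = rectangular hull of q ∷ qs.
Placed : Letter → Point → Point → Point → List Point → Set
Placed u   pᵢ p q qs = maxY q qs ℤ.< Y pᵢ × BetweenPtInt (X pᵢ) (X p) (minX q qs) (maxX q qs)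
Placed d   pᵢ p q qs = Y pᵢ ℤ.< minY q qs × BetweenPtInt (X pᵢ) (X p) (minX q qs) (maxX q qs)
Placed rᵤ  pᵢ p q qs = maxX q qs ℤ.< X pᵢ × BetweenPtInt (Y pᵢ) (Y p) (minY q qs) (maxY q qs)
Placed r_d pᵢ p q qs = maxX q qs ℤ.< X pᵢ × BetweenPtInt (Y pᵢ) (Y p) (minY q qs) (maxY q qs)

LaterStep : Letter → Point → Point → Point → List Point → Set
LaterStep a pᵢ p q qs = ¬ InHull pᵢ p (q ∷ qs) × Placed a pᵢ p q qs

-- Validity of a construction, with the word and the point list both
-- given in REVERSED order (newest letter / newest point first).
ValidRev : Word → List Point → Set
ValidRev [] (p₀ ∷ []) = ⊤
ValidRev (a ∷ []) (p₁ ∷ p₀ ∷ []) = FirstStep a p₁ p₀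
ValidRev (a ∷ as@(_ ∷ _)) (pᵢ ∷ p ∷ q ∷ qs) = LaterStep a pᵢ p q qs × ValidRev as (p ∷ q ∷ qs)
ValidRev _ _ = ⊥

reverse : {A : Set} → List A → List A
reverse = Data.List.reverse

DistinctCoords : List Point → Set
DistinctCoords = AllPairs (λ p q → X p ≢ X q × Y p ≢ Y q)

-- ps = p₀ ∷ p₁ ∷ … ∷ pₙ is a valid construction for the word w (|w| = n)
Construction : Word → List Point → Set
Construction w ps = DistinctCoords ps × ValidRev (reverse w) (reverse ps)

-- one-line notation, values 1,…,n
IsPerm : List ℕ → Set
IsPerm π = π ↭ applyUpTo suc (length π)

plot : List ℕ → List Point
plot π = Data.List.map (λ { (i , v) → (+ i , + v) }) (zip (upTo (length π)) π)

OrderIso : List Point → List Point → Set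
OrderIso A B =
  Σ (Fin (length A) → Fin (length B)) λ f →
    Bijective _≡_ _≡_ f ×
    (∀ i j → (X (lookup A i) ℤ.< X (lookup A j)) ⇔ (X (lookup B (f i)) ℤ.< X (lookup B (f j)))) ×
    (∀ i j → (Y (lookup A i) ℤ.< Y (lookup A j)) ⇔ (Y (lookup B (f i)) ℤ.< Y (lookup B (f j))))

SeqIso : List ℕ → List ℕ → Set
SeqIso s t = Σ (length s ≡ length t) λ eq →
  ∀ i j → (lookup s i ℕ.< lookup s j) ⇔ (lookup t (cast eq i) ℕ.< lookup t (cast eq j))

Contains : List ℕ → List ℕ → Set
Contains π σ = Σ (List ℕ) λ τ → τ ⊆ π × SeqIso τ σ

-- ψ°_w = π  : π is order-isomorphic to {p₁,…,pₙ} of a construction for w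
IsPsiCirc : Word → List ℕ → Set
IsPsiCirc w π = IsPerm π × Σ (List Point) λ ps → Construction w ps × OrderIso (plot π) (drop 1 ps)

-- ψ•_w = π  : π is order-isomorphic to {p₀,p₁,…,pₙ} of a construction for w
IsPsiBullet : Word → List ℕ → Set
IsPsiBullet w π = IsPerm π × Σ (List Point) λ ps → Construction w ps × OrderIso (plot π) ps

-- In a word of 𝒫 a vertical letter (u, d) is always followed by a horizontal one
-- (rᵤ, r_d) and vice versa, in the pattern dictated by ρ.  By induction along the
-- construction, each new point lies beyond all earlier points in the direction of
-- its letter, and therefore its position relative to an earlier point pᵢ is fixed by
-- its letter alone, except relative to its immediate predecessor (when that is not
-- the origin), where it is fixed by the turn the path takes.  So the order type of a
-- construction depends only on the word.  If v occupies positions k+1, …, k+|v| of w,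
-- the points p_{k+1}, …, p_{k+|v|} of w together with p_{k-1} (p₀ if k = 0) in the
-- role of the origin have the order type of the construction for v; p_k itself has to
-- be skipped because p_{k+1} is a turn relative to it.  Removing the origin on both
-- sides gives the statement for ψ°.

module Submission where

open import Defs
open import Data.Bool using (Bool; true; false; not)
open import Data.Empty using (⊥)
open import Data.Fin as Fin using (Fin; zero; suc)
import Data.Fin.Properties as Fin
open import Data.Integer as ℤ using (ℤ; +_; _⊓_; _⊔_)
import Data.Integer.Properties as ℤ
open import Data.List
  using (List; []; _∷_; _++_; [_]; length; lookup; tabulate; map; zip; applyUpTo; drop; foldr; null; reverseAcc)
open import Data.List.Membership.Propositional using (_∈_)
open import Data.List.Properties
  using (++-identityʳ; ++-assoc; reverse-++; unfold-reverse; reverse-involutive; tabulate-cong; length-tabulate; lookup-tabulate)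
open import Data.List.Relation.Binary.Pointwise as Pointwise using (Pointwise; []; _∷_)
open import Data.List.Relation.Binary.Sublist.Propositional using (_⊆_; _∷_; _∷ʳ_; ⊆-refl; ⊆-trans)
open import Data.List.Relation.Binary.Sublist.Propositional.Properties
  using (All-resp-⊆; []⊆-universal; drop⁺-≥; drop⁺-⊆; reverse⁺)
open import Data.List.Relation.Unary.All as All using (All; []; _∷_)
open import Data.List.Relation.Unary.Any using (here; there)
open import Data.List.Relation.Unary.Linked as Linked using (Linked; []; [-]; _∷_)
import Data.Nat as ℕ
open import Data.Nat using (ℕ; zero; suc; z≤n)
open import Data.Nat.Properties using (suc-injective)
open import Data.Product using (∃; _×_; _,_; proj₁; proj₂; swap)
open import Data.Sum using (inj₁; inj₂)
open import Data.Unit using (⊤; tt)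
open import Function using (_∘_; id; flip; const)
open import Function.Bundles using (_⇔_; mk⇔; Equivalence)
open import Function.Properties.Equivalence using () renaming (refl to ⇔-refl; sym to ⇔-sym; trans to ⇔-trans)
open import Relation.Binary.PropositionalEquality
  using (_≡_; refl; sym; trans; cong; subst; subst₂; module ≡-Reasoning)
open import Relation.Nullary using (contradiction)

module _ {A : Set} {R : A → A → Set} where

  linked-++⁻ˡ : ∀ xs {ys} → Linked R (xs ++ ys) → Linked R xs
  linked-++⁻ˡ []           _            = []
  linked-++⁻ˡ (x ∷ [])     _            = [-]
  linked-++⁻ˡ (x ∷ y ∷ xs) (xRy ∷ linked) = xRy ∷ linked-++⁻ˡ (y ∷ xs) linked

  linked-++⁻ʳ : ∀ xs {ys} → Linked R (xs ++ ys) → Linked R ys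
  linked-++⁻ʳ []       linked = linked
  linked-++⁻ʳ (x ∷ xs) linked = linked-++⁻ʳ xs (Linked.tail linked)

  linked-reverseAcc : ∀ {x acc} xs → Linked R (x ∷ acc) → Linked (flip R) (x ∷ xs) →
                      Linked R (reverseAcc (x ∷ acc) xs)
  linked-reverseAcc []       linked _               = linked
  linked-reverseAcc (y ∷ xs) linked (yRx ∷ flipped) = linked-reverseAcc xs (yRx ∷ linked) flipped

  linked-reverse : ∀ xs → Linked (flip R) xs → Linked R (reverse xs)
  linked-reverse []       _       = []
  linked-reverse (x ∷ xs) flipped = linked-reverseAcc xs [-] flipped

module _ {A : Set} where

  sublist-index : ∀ {xs ys : List A} → xs ⊆ ys → Fin (length xs) → Fin (length ys)
  sublist-index (_ ∷ʳ xs⊆ys) i       = suc (sublist-index xs⊆ys i)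
  sublist-index (_ ∷ _)      zero    = zero
  sublist-index (_ ∷ xs⊆ys)  (suc i) = suc (sublist-index xs⊆ys i)

  lookup-sublist-index : ∀ {xs ys : List A} (xs⊆ys : xs ⊆ ys) i → lookup ys (sublist-index xs⊆ys i) ≡ lookup xs i
  lookup-sublist-index (_ ∷ʳ xs⊆ys) i       = lookup-sublist-index xs⊆ys i
  lookup-sublist-index (refl ∷ _)   zero    = refl
  lookup-sublist-index (_ ∷ xs⊆ys)  (suc i) = lookup-sublist-index xs⊆ys i

  lookup-tabulate′ : ∀ {n} (f : Fin n → A) i → lookup (tabulate f) i ≡ f (Fin.cast (length-tabulate f) i)
  lookup-tabulate′ f i = begin
    lookup (tabulate f) i                                       ≡⟨ cong (lookup (tabulate f)) (sym cast-cast) ⟩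
    lookup (tabulate f) (Fin.cast _ (Fin.cast (length-tabulate f) i)) ≡⟨ lookup-tabulate f _ ⟩
    f (Fin.cast (length-tabulate f) i)                          ∎
    where
    open ≡-Reasoning
    cast-cast : Fin.cast (sym (length-tabulate f)) (Fin.cast (length-tabulate f) i) ≡ i
    cast-cast = Fin.cast-involutive (sym (length-tabulate f)) (length-tabulate f) i

Increasing : ∀ {m n} → (Fin m → Fin n) → Set
Increasing g = ∀ {i j} → i Fin.< j → g i Fin.< g j

module _ {m n} (g : Fin m → Fin (suc n)) (positive : ∀ i → 0 ℕ.< Fin.toℕ (g i)) where

  lower : Fin m → Fin n
  lower i with g i | positive i
  ... | suc k | _ = k

  suc-lower : ∀ i → suc (lower i) ≡ g i
  suc-lower i with g i | positive i
  ... | suc k | _ = refl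

  lower-increasing : Increasing g → Increasing lower
  lower-increasing increasing {i} {j} i<j =
    ℕ.s<s⁻¹ (subst₂ Fin._<_ (sym (suc-lower i)) (sym (suc-lower j)) (increasing i<j))

module _ {A : Set} where

  tabulate-lookup-⊆ : ∀ (xs : List A) {m} (g : Fin m → Fin (length xs)) → Increasing g → tabulate (lookup xs ∘ g) ⊆ xs
  tabulate-lookup-⊆ xs       {zero}  g _          = []⊆-universal xs
  tabulate-lookup-⊆ []       {suc m} g _          with g zero
  ... | ()
  tabulate-lookup-⊆ (x ∷ xs) {suc m} g increasing = split (g zero) refl
    where
    split : ∀ k → g zero ≡ k → lookup (x ∷ xs) (g zero) ∷ tabulate (lookup (x ∷ xs) ∘ g ∘ suc) ⊆ x ∷ xs
    split zero g0≡0 = cong (lookup (x ∷ xs)) g0≡0 ∷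
      subst (_⊆ xs) (tabulate-cong λ i → cong (lookup (x ∷ xs)) (suc-lower (g ∘ suc) positive i))
        (tabulate-lookup-⊆ xs (lower (g ∘ suc) positive) (lower-increasing (g ∘ suc) positive (increasing ∘ ℕ.s<s)))
      where
      positive : ∀ i → 0 ℕ.< Fin.toℕ (g (suc i))
      positive i = subst (Fin._< g (suc i)) g0≡0 (increasing ℕ.z<s)
    split (suc _) g0≡suc = x ∷ʳ
      subst (_⊆ xs) (tabulate-cong λ i → cong (lookup (x ∷ xs)) (suc-lower g positive i))
        (tabulate-lookup-⊆ xs (lower g positive) (lower-increasing g positive increasing))
      where
      positive : ∀ i → 0 ℕ.< Fin.toℕ (g i)
      positive zero    = subst (λ k → 0 ℕ.< Fin.toℕ k) (sym g0≡suc) ℕ.z<s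
      positive (suc i) = Fin.<-trans (positive zero) (increasing ℕ.z<s)

-- Rectangular hulls

-- lowest X q qs is minX q qs, and likewise for maxX, minY and maxY.
lowest highest : (Point → ℤ) → Point → List Point → ℤ
lowest  F q qs = foldr (λ p m → F p ⊓ m) (F q) qs
highest F q qs = foldr (λ p m → F p ⊔ m) (F q) qs

module _ (F : Point → ℤ) where

  lowest-≤ : ∀ q qs {o} → o ∈ q ∷ qs → lowest F q qs ℤ.≤ F o
  lowest-≤ q []       (here refl)         = ℤ.≤-refl
  lowest-≤ q (o ∷ qs) (here refl)         = ℤ.≤-trans (ℤ.i⊓j≤j (F o) _) (lowest-≤ q qs (here refl))
  lowest-≤ q (o ∷ qs) (there (here refl)) = ℤ.i⊓j≤i (F o) _
  lowest-≤ q (o ∷ qs) (there (there o∈))  = ℤ.≤-trans (ℤ.i⊓j≤j (F o) _) (lowest-≤ q qs (there o∈))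

  ≤-highest : ∀ q qs {o} → o ∈ q ∷ qs → F o ℤ.≤ highest F q qs
  ≤-highest q []       (here refl)         = ℤ.≤-refl
  ≤-highest q (o ∷ qs) (here refl)         = ℤ.≤-trans (≤-highest q qs (here refl)) (ℤ.i≤j⊔i (F o) _)
  ≤-highest q (o ∷ qs) (there (here refl)) = ℤ.i≤i⊔j (F o) _
  ≤-highest q (o ∷ qs) (there (there o∈))  = ℤ.≤-trans (≤-highest q qs (there o∈)) (ℤ.i≤j⊔i (F o) _)

  lowest≤highest : ∀ q qs → lowest F q qs ℤ.≤ highest F q qs
  lowest≤highest q qs = ℤ.≤-trans (lowest-≤ q qs (here refl)) (≤-highest q qs (here refl))

  highest-< : ∀ q qs {c} → All (λ o → F o ℤ.< c) (q ∷ qs) → highest F q qs ℤ.< c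
  highest-< q []       (q<c ∷ [])         = q<c
  highest-< q (o ∷ qs) (q<c ∷ o<c ∷ os<c) with ℤ.⊔-sel (F o) (highest F q qs)
  ... | inj₁ eq rewrite eq = o<c
  ... | inj₂ eq rewrite eq = highest-< q qs (q<c ∷ os<c)

  <-lowest : ∀ q qs {c} → All (λ o → c ℤ.< F o) (q ∷ qs) → c ℤ.< lowest F q qs
  <-lowest q []       (c<q ∷ [])         = c<q
  <-lowest q (o ∷ qs) (c<q ∷ c<o ∷ c<os) with ℤ.⊓-sel (F o) (lowest F q qs)
  ... | inj₁ eq rewrite eq = c<o
  ... | inj₂ eq rewrite eq = <-lowest q qs (c<q ∷ c<os)

inHull : ∀ {p q qs a b c e} → a ∈ q ∷ qs → b ∈ q ∷ qs → c ∈ q ∷ qs → e ∈ q ∷ qs →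
         X a ℤ.≤ X p → X p ℤ.≤ X b → Y c ℤ.≤ Y p → Y p ℤ.≤ Y e → InHull p q qs
inHull {q = q} {qs} a∈ b∈ c∈ e∈ a≤p p≤b c≤p p≤e =
  (ℤ.≤-trans (lowest-≤ X q qs a∈) a≤p , ℤ.≤-trans p≤b (≤-highest X q qs b∈)) ,
  (ℤ.≤-trans (lowest-≤ Y q qs c∈) c≤p , ℤ.≤-trans p≤e (≤-highest Y q qs e∈))

between-above : ∀ {a b lo hi} → lo ℤ.≤ hi → hi ℤ.< b → BetweenPtInt a b lo hi → hi ℤ.< a × a ℤ.< b
between-above _     _    (inj₁ bounds)       = bounds
between-above lo≤hi hi<b (inj₂ (b<a , a<lo)) =
  contradiction (ℤ.<-trans (ℤ.<-trans b<a a<lo) (ℤ.≤-<-trans lo≤hi hi<b)) (ℤ.<-irrefl refl)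

between-below : ∀ {a b lo hi} → lo ℤ.≤ hi → b ℤ.< lo → BetweenPtInt a b lo hi → b ℤ.< a × a ℤ.< lo
between-below _     _    (inj₂ bounds)       = bounds
between-below lo≤hi b<lo (inj₁ (hi<a , a<b)) =
  contradiction (ℤ.<-trans (ℤ.<-trans hi<a a<b) (ℤ.<-≤-trans b<lo lo≤hi)) (ℤ.<-irrefl refl)

-- One step of the construction

Ordered : Bool → ℤ → ℤ → Set
Ordered true  x y = x ℤ.< y
Ordered false x y = y ℤ.< x

-- The position of a point p created by the letter a relative to an earlier point o;
-- tight means that o is the point created immediately before p and is not the origin.
rightward upward : Letter → Bool → Bool
rightward u   true  = false
rightward d   true  = false
rightward _   _     = true
upward    u   _     = true
upward    d   _     = false
upward    rᵤ  tight = not tight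
upward    r_d tight = tight

Located : Letter → Bool → Point → Point → Set
Located a tight o p = Ordered (rightward a tight) (X o) (X p) × Ordered (upward a tight) (Y o) (Y p)

Placement : Letter → Bool → Point → List Point → Set
Placement a tight p []       = ⊥
Placement a tight p (q ∷ os) = Located a tight q p × All (λ o → Located a false o p) os

Extends : Letter → Point → Point → Set
Extends u   o p = Y o ℤ.< Y p
Extends d   o p = Y p ℤ.< Y o
Extends rᵤ  o p = X o ℤ.< X p
Extends r_d o p = X o ℤ.< X p

located⇒extends : ∀ a tight {o p} → Located a tight o p → Extends a o p
located⇒extends u   _ (_ , o<p) = o<p
located⇒extends d   _ (_ , p<o) = p<o
located⇒extends rᵤ  _ (o<p , _) = o<p
located⇒extends r_d _ (o<p , _) = o<p

module _ {p q o : Point} {os : List Point} where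

  private
    q∈ : q ∈ q ∷ o ∷ os
    q∈ = here refl

    o∈ : o ∈ q ∷ o ∷ os
    o∈ = there (here refl)

    below-max : ∀ F {c o′} → highest F o os ℤ.< c → o′ ∈ o ∷ os → F o′ ℤ.< c
    below-max F max<c o′∈ = ℤ.≤-<-trans (≤-highest F o os o′∈) max<c

    above-min : ∀ F {c o′} → c ℤ.< lowest F o os → o′ ∈ o ∷ os → c ℤ.< F o′
    above-min F c<min o′∈ = ℤ.<-≤-trans c<min (lowest-≤ F o os o′∈)

  rightmost-then-up : All (λ o′ → X o′ ℤ.< X q) (o ∷ os) → LaterStep u p q o os → Placement u true p (q ∷ o ∷ os)
  rightmost-then-up q-right (outside , maxY<p , between)
    with between-above (lowest≤highest X o os) (highest-< X o os q-right) between
  ... | maxX<p , p<q =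
    (p<q , q<p) , All.tabulate λ o′∈ → below-max X maxX<p o′∈ , below-max Y maxY<p o′∈
    where
    q<p : Y q ℤ.< Y p
    q<p = ℤ.≰⇒> λ p≤q → outside (inHull o∈ q∈ o∈ q∈
            (ℤ.<⇒≤ (below-max X maxX<p (here refl))) (ℤ.<⇒≤ p<q) (ℤ.<⇒≤ (below-max Y maxY<p (here refl))) p≤q)

  rightmost-then-down : All (λ o′ → X o′ ℤ.< X q) (o ∷ os) → LaterStep d p q o os → Placement d true p (q ∷ o ∷ os)
  rightmost-then-down q-right (outside , p<minY , between)
    with between-above (lowest≤highest X o os) (highest-< X o os q-right) between
  ... | maxX<p , p<q =
    (p<q , p<qʸ) , All.tabulate λ o′∈ → below-max X maxX<p o′∈ , above-min Y p<minY o′∈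
    where
    p<qʸ : Y p ℤ.< Y q
    p<qʸ = ℤ.≰⇒> λ q≤p → outside (inHull o∈ q∈ q∈ o∈
            (ℤ.<⇒≤ (below-max X maxX<p (here refl))) (ℤ.<⇒≤ p<q) q≤p (ℤ.<⇒≤ (above-min Y p<minY (here refl))))

  topmost-then-right : All (λ o′ → Y o′ ℤ.< Y q) (o ∷ os) → LaterStep rᵤ p q o os → Placement rᵤ true p (q ∷ o ∷ os)
  topmost-then-right q-top (outside , maxX<p , between)
    with between-above (lowest≤highest Y o os) (highest-< Y o os q-top) between
  ... | maxY<p , p<q =
    (q<p , p<q) , All.tabulate λ o′∈ → below-max X maxX<p o′∈ , below-max Y maxY<p o′∈
    where
    q<p : X q ℤ.< X p
    q<p = ℤ.≰⇒> λ p≤q → outside (inHull o∈ q∈ o∈ q∈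
            (ℤ.<⇒≤ (below-max X maxX<p (here refl))) p≤q (ℤ.<⇒≤ (below-max Y maxY<p (here refl))) (ℤ.<⇒≤ p<q))

  bottommost-then-right : All (λ o′ → Y q ℤ.< Y o′) (o ∷ os) → LaterStep r_d p q o os → Placement r_d true p (q ∷ o ∷ os)
  bottommost-then-right q-bottom (outside , maxX<p , between)
    with between-below (lowest≤highest Y o os) (<-lowest Y o os q-bottom) between
  ... | q<pʸ , p<minY =
    (q<p , q<pʸ) , All.tabulate λ o′∈ → below-max X maxX<p o′∈ , above-min Y p<minY o′∈
    where
    q<p : X q ℤ.< X p
    q<p = ℤ.≰⇒> λ p≤q → outside (inHull o∈ q∈ q∈ o∈
            (ℤ.<⇒≤ (below-max X maxX<p (here refl))) p≤q (ℤ.<⇒≤ q<pʸ) (ℤ.<⇒≤ (above-min Y p<minY (here refl))))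

data Consecutive : Letter → Letter → Set where
  u-rᵤ  : Consecutive u rᵤ
  d-r_d : Consecutive d r_d
  rᵤ-u  : Consecutive rᵤ u
  rᵤ-d  : Consecutive rᵤ d
  r_d-u : Consecutive r_d u
  r_d-d : Consecutive r_d d

turn : ∀ {a b p q o os} → Consecutive b a → All (λ o′ → Extends b o′ q) (o ∷ os) →
       LaterStep a p q o os → Placement a true p (q ∷ o ∷ os)
turn u-rᵤ  = topmost-then-right
turn d-r_d = bottommost-then-right
turn rᵤ-u  = rightmost-then-up
turn rᵤ-d  = rightmost-then-down
turn r_d-u = rightmost-then-up
turn r_d-d = rightmost-then-down

ρ-alternating : ∀ x → Linked Consecutive (ρ x)
ρ-alternating []                  = []
ρ-alternating (false ∷ [])        = d-r_d ∷ [-]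
ρ-alternating (true ∷ [])         = u-rᵤ ∷ [-]
ρ-alternating (false ∷ false ∷ x) = d-r_d ∷ r_d-d ∷ ρ-alternating (false ∷ x)
ρ-alternating (false ∷ true ∷ x)  = d-r_d ∷ r_d-u ∷ ρ-alternating (true ∷ x)
ρ-alternating (true ∷ false ∷ x)  = u-rᵤ ∷ rᵤ-d ∷ ρ-alternating (false ∷ x)
ρ-alternating (true ∷ true ∷ x)   = u-rᵤ ∷ rᵤ-u ∷ ρ-alternating (true ∷ x)

𝒫-alternating : ∀ {w} → In𝒫 w → Linked Consecutive w
𝒫-alternating {w} (x , pre , suf , w-in-ρx) =
  linked-++⁻ˡ w (linked-++⁻ʳ pre (subst (Linked Consecutive) (sym w-in-ρx) (ρ-alternating x)))

-- Shapes of constructions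

-- Word and points are reversed (newest first), as in ValidRev.
Shape : Word → List Point → Set
Shape []       (p ∷ []) = ⊤
Shape (a ∷ as) (p ∷ qs) = Placement a (not (null as)) p qs × Shape as qs
Shape _        _        = ⊥

shape⇒extends : ∀ {b as q o os} → Shape (b ∷ as) (q ∷ o ∷ os) → All (λ o′ → Extends b o′ q) (o ∷ os)
shape⇒extends {b} ((located , locateds) , _) =
  located⇒extends b _ located ∷ All.map (located⇒extends b false) locateds

firstStep⇒located : ∀ a {p₁ p₀} → FirstStep a p₁ p₀ → Located a false p₀ p₁
firstStep⇒located u   step = step
firstStep⇒located d   step = step
firstStep⇒located rᵤ  step = step
firstStep⇒located r_d step = step

validRev⇒shape : ∀ rw rps → Linked (flip Consecutive) rw → ValidRev rw rps → Shape rw rps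
validRev⇒shape []           (p ∷ [])         _                 _              = tt
validRev⇒shape (a ∷ [])     (p₁ ∷ p₀ ∷ [])   _                 step           = (firstStep⇒located a step , []) , tt
validRev⇒shape (a ∷ b ∷ as) (p ∷ q ∷ o ∷ os) (ba ∷ alternating) (step , valid) =
  turn ba (shape⇒extends shape) step , shape
  where
  shape : Shape (b ∷ as) (q ∷ o ∷ os)
  shape = validRev⇒shape (b ∷ as) (q ∷ o ∷ os) alternating valid

construction⇒shape : ∀ {w ps} → In𝒫 w → Construction w ps → Shape (reverse w) (reverse ps)
construction⇒shape {w} {ps} w∈𝒫 (_ , valid) =
  validRev⇒shape (reverse w) (reverse ps) (linked-reverse w (𝒫-alternating w∈𝒫)) valid

shape-length : ∀ rw ps → Shape rw ps → length ps ≡ suc (length rw)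
shape-length []       (_ ∷ []) _           = refl
shape-length (_ ∷ rw) (_ ∷ ps) (_ , shape) = cong suc (shape-length rw ps shape)

shape-drop : ∀ S {rw} ps → Shape (S ++ rw) ps → Shape rw (drop (length S) ps)
shape-drop []      ps       shape       = shape
shape-drop (_ ∷ S) (_ ∷ ps) (_ , shape) = shape-drop S ps shape

-- The point created by b is skipped and the next older point becomes the origin;
-- relative to it, the first point of a ∷ rw is not tight.
shape-skip : ∀ a rw b P p ps → Shape (a ∷ rw ++ b ∷ P) (p ∷ ps) →
             ∃ λ sub → sub ⊆ ps × Shape (a ∷ rw) (p ∷ sub)
shape-skip a [] b P p (q ∷ o ∷ os) ((_ , o-located ∷ _) , _) =
  o ∷ [] , q ∷ʳ refl ∷ []⊆-universal os , (o-located , []) , tt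
shape-skip a (a′ ∷ rw) b P p (q ∷ os) ((q-located , os-located) , shape)
  with shape-skip a′ rw b P q os shape
... | sub , sub⊆os , sub-shape =
  q ∷ sub , refl ∷ sub⊆os , (q-located , All-resp-⊆ sub⊆os os-located) , sub-shape

shape-prefix : ∀ rw P ps → Shape (rw ++ P) ps → ∃ λ sub → sub ⊆ ps × Shape rw sub
shape-prefix rw       []      ps           shape rewrite ++-identityʳ rw = ps , ⊆-refl , shape
shape-prefix []       (_ ∷ _) (p ∷ q ∷ os) _     = q ∷ [] , p ∷ʳ refl ∷ []⊆-universal os , tt
shape-prefix (a ∷ rw) (b ∷ P) (p ∷ ps)     shape with shape-skip a rw b P p ps shape
... | sub , sub⊆ps , sub-shape = p ∷ sub , refl ∷ sub⊆ps , sub-shape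

shape-infix : ∀ S rw P ps → Shape (S ++ rw ++ P) ps → ∃ λ sub → sub ⊆ ps × Shape rw sub
shape-infix S rw P ps shape with shape-prefix rw P (drop (length S) ps) (shape-drop S ps shape)
... | sub , sub⊆ , sub-shape = sub , ⊆-trans sub⊆ (drop⁺-≥ {m = length S} z≤n) , sub-shape

-- Order types of point lists

SameSide : ℤ → ℤ → ℤ → ℤ → Set
SameSide x y x′ y′ = (x ℤ.< y ⇔ x′ ℤ.< y′) × (y ℤ.< x ⇔ y′ ℤ.< x′)

Agree : Point → Point → Point → Point → Set
Agree p o p′ o′ = SameSide (X p) (X o) (X p′) (X o′) × SameSide (Y p) (Y o) (Y p′) (Y o′)

agree-swap : ∀ {p o p′ o′} → Agree p o p′ o′ → Agree o p o′ p′
agree-swap (x-side , y-side) = swap x-side , swap y-side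

sameSide-refl : ∀ {x x′} → SameSide x x x′ x′
sameSide-refl = irreflexive , irreflexive
  where
  irreflexive : ∀ {x x′} → x ℤ.< x ⇔ x′ ℤ.< x′
  irreflexive = mk⇔ (λ x<x → contradiction x<x (ℤ.<-irrefl refl)) (λ x′<x′ → contradiction x′<x′ (ℤ.<-irrefl refl))

<-sameSide : ∀ {x y x′ y′} → x ℤ.< y → x′ ℤ.< y′ → SameSide x y x′ y′
<-sameSide x<y x′<y′ =
  mk⇔ (const x′<y′) (const x<y) ,
  mk⇔ (λ y<x → contradiction y<x (ℤ.<-asym x<y)) (λ y′<x′ → contradiction y′<x′ (ℤ.<-asym x′<y′))

ordered-sameSide : ∀ c {x y x′ y′} → Ordered c x y → Ordered c x′ y′ → SameSide x y x′ y′
ordered-sameSide true  x<y x′<y′ = <-sameSide x<y x′<y′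
ordered-sameSide false y<x y′<x′ = swap (<-sameSide y<x y′<x′)

located-agree : ∀ a tight {o p o′ p′} → Located a tight o p → Located a tight o′ p′ → Agree p o p′ o′
located-agree a tight (x-order , y-order) (x-order′ , y-order′) = agree-swap
  (ordered-sameSide (rightward a tight) x-order x-order′ , ordered-sameSide (upward a tight) y-order y-order′)

data SameOrderType : List Point → List Point → Set where
  []  : SameOrderType [] []
  _∷_ : ∀ {p p′ ps ps′} → Pointwise (λ o o′ → Agree p o p′ o′) ps ps′ → SameOrderType ps ps′ →
        SameOrderType (p ∷ ps) (p′ ∷ ps′)

locateds-agree : ∀ a tight {p p′} os os′ → length os ≡ length os′ →
                 All (λ o → Located a tight o p) os → All (λ o′ → Located a tight o′ p′) os′ →
                 Pointwise (λ o o′ → Agree p o p′ o′) os os′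
locateds-agree a tight []       []         _           []                      []                        = []
locateds-agree a tight (o ∷ os) (o′ ∷ os′) same-length (o-located ∷ os-located) (o′-located ∷ os′-located) =
  located-agree a tight o-located o′-located ∷
  locateds-agree a tight os os′ (suc-injective same-length) os-located os′-located

shapes⇒sameOrderType : ∀ rw ps ps′ → Shape rw ps → Shape rw ps′ → SameOrderType ps ps′
shapes⇒sameOrderType []       (p ∷ [])        (p′ ∷ [])         _ _ = [] ∷ []
shapes⇒sameOrderType (a ∷ rw) (p ∷ q ∷ os) (p′ ∷ q′ ∷ os′)
                     ((q-located , os-located) , shape) ((q′-located , os′-located) , shape′) =
  (located-agree a _ q-located q′-located ∷
   locateds-agree a false os os′ (suc-injective same-length) os-located os′-located) ∷
  shapes⇒sameOrderType rw (q ∷ os) (q′ ∷ os′) shape shape′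
  where
  same-length : length (q ∷ os) ≡ length (q′ ∷ os′)
  same-length = trans (shape-length rw (q ∷ os) shape) (sym (shape-length rw (q′ ∷ os′) shape′))

sameOrderType-∷ʳ : ∀ {p p′ ps ps′} → SameOrderType ps ps′ → Pointwise (λ o o′ → Agree o p o′ p′) ps ps′ →
                   SameOrderType (ps ++ [ p ]) (ps′ ++ [ p′ ])
sameOrderType-∷ʳ []                   []                = [] ∷ []
sameOrderType-∷ʳ (agrees ∷ sameOrder) (agree ∷ agrees′) =
  Pointwise.++⁺ agrees (agree ∷ []) ∷ sameOrderType-∷ʳ sameOrder agrees′

sameOrderType-reverse : ∀ {ps ps′} → SameOrderType ps ps′ → SameOrderType (reverse ps) (reverse ps′)
sameOrderType-reverse []                                          = []
sameOrderType-reverse {p ∷ ps} {p′ ∷ ps′} (agrees ∷ sameOrder) =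
  subst₂ SameOrderType (sym (unfold-reverse p ps)) (sym (unfold-reverse p′ ps′))
    (sameOrderType-∷ʳ (sameOrderType-reverse sameOrder) (Pointwise.reverse⁺ (Pointwise.map agree-swap agrees)))

sameOrderType-drop : ∀ n {A B} → SameOrderType A B → SameOrderType (drop n A) (drop n B)
sameOrderType-drop zero    same       = same
sameOrderType-drop (suc n) []         = []
sameOrderType-drop (suc n) (_ ∷ same) = sameOrderType-drop n same

reverse-infix : ∀ {A : Set} (pre v suf : List A) → reverse (pre ++ v ++ suf) ≡ reverse suf ++ reverse v ++ reverse pre
reverse-infix pre v suf = begin
  reverse (pre ++ v ++ suf)                 ≡⟨ reverse-++ pre (v ++ suf) ⟩
  reverse (v ++ suf) ++ reverse pre         ≡⟨ cong (_++ reverse pre) (reverse-++ v suf) ⟩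
  (reverse suf ++ reverse v) ++ reverse pre ≡⟨ ++-assoc (reverse suf) (reverse v) (reverse pre) ⟩
  reverse suf ++ reverse v ++ reverse pre   ∎
  where open ≡-Reasoning

factor-sameOrderType : ∀ {v w qs ps} → In𝒫 v → In𝒫 w → Factor v w → Construction v qs → Construction w ps →
                       ∃ λ sub → sub ⊆ ps × SameOrderType qs sub
factor-sameOrderType {v} {qs = qs} {ps} v∈𝒫 w∈𝒫 (pre , suf , refl) v-construction w-construction
  with shape-infix (reverse suf) (reverse v) (reverse pre) (reverse ps)
         (subst (λ rw → Shape rw (reverse ps)) (reverse-infix pre v suf) (construction⇒shape w∈𝒫 w-construction))
... | sub , sub⊆ , sub-shape =
  reverse sub ,
  subst (reverse sub ⊆_) (reverse-involutive ps) (reverse⁺ sub⊆) ,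
  subst (λ qs′ → SameOrderType qs′ (reverse sub)) (reverse-involutive qs)
    (sameOrderType-reverse (shapes⇒sameOrderType (reverse v) (reverse qs) sub (construction⇒shape v∈𝒫 v-construction) sub-shape))

PreservesOrder : (Point → ℤ) → (A B : List Point) → (Fin (length A) → Fin (length B)) → Set
PreservesOrder F A B f = ∀ i j → F (lookup A i) ℤ.< F (lookup A j) ⇔ F (lookup B (f i)) ℤ.< F (lookup B (f j))

record OrderEmbedding (A B : List Point) : Set where
  field
    index       : Fin (length A) → Fin (length B)
    preserves-X : PreservesOrder X A B index
    preserves-Y : PreservesOrder Y A B index

open OrderEmbedding

preservesOrder-∘ : ∀ F A B C {f g} → PreservesOrder F A B f → PreservesOrder F B C g → PreservesOrder F A C (g ∘ f)
preservesOrder-∘ F A B C {f} f-preserves g-preserves i j = ⇔-trans (f-preserves i j) (g-preserves (f i) (f j))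

preservesOrder-inverse : ∀ F A B {f g} → (∀ j → f (g j) ≡ j) → PreservesOrder F A B f → PreservesOrder F B A g
preservesOrder-inverse F A B {f} {g} inverse f-preserves i j =
  ⇔-sym (subst₂ (λ i′ j′ → F (lookup A (g i)) ℤ.< F (lookup A (g j)) ⇔ F (lookup B i′) ℤ.< F (lookup B j′))
           (inverse i) (inverse j) (f-preserves (g i) (g j)))

preservesOrder-lookup : ∀ F A B {f} → (∀ i → lookup B (f i) ≡ lookup A i) → PreservesOrder F A B f
preservesOrder-lookup F A B lookup-f i j =
  subst₂ (λ p p′ → F (lookup A i) ℤ.< F (lookup A j) ⇔ F p ℤ.< F p′) (sym (lookup-f i)) (sym (lookup-f j)) ⇔-refl

orderEmbedding-trans : ∀ {A B C} → OrderEmbedding A B → OrderEmbedding B C → OrderEmbedding A C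
orderEmbedding-trans {A} {B} {C} e e′ = record
  { index       = index e′ ∘ index e
  ; preserves-X = preservesOrder-∘ X A B C (preserves-X e) (preserves-X e′)
  ; preserves-Y = preservesOrder-∘ Y A B C (preserves-Y e) (preserves-Y e′)
  }

orderIso⇒orderEmbedding : ∀ {A B} → OrderIso A B → OrderEmbedding A B
orderIso⇒orderEmbedding (f , _ , x-iso , y-iso) = record { index = f ; preserves-X = x-iso ; preserves-Y = y-iso }

orderIso⇒orderEmbedding⁻¹ : ∀ {A B} → OrderIso A B → OrderEmbedding B A
orderIso⇒orderEmbedding⁻¹ {A} {B} (f , (_ , surjective) , x-iso , y-iso) = record
  { index       = g
  ; preserves-X = preservesOrder-inverse X A B inverse x-iso
  ; preserves-Y = preservesOrder-inverse Y A B inverse y-iso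
  }
  where
  g : Fin (length B) → Fin (length A)
  g j = proj₁ (surjective j)

  inverse : ∀ j → f (g j) ≡ j
  inverse j = proj₂ (surjective j) refl

⊆⇒orderEmbedding : ∀ {A B} → A ⊆ B → OrderEmbedding A B
⊆⇒orderEmbedding {A} {B} A⊆B = record
  { index       = sublist-index A⊆B
  ; preserves-X = preservesOrder-lookup X A B (lookup-sublist-index A⊆B)
  ; preserves-Y = preservesOrder-lookup Y A B (lookup-sublist-index A⊆B)
  }

sameOrderType-index : ∀ {A B} → SameOrderType A B → Fin (length A) → Fin (length B)
sameOrderType-index (_ ∷ _)    zero    = zero
sameOrderType-index (_ ∷ same) (suc i) = suc (sameOrderType-index same i)

pointwise-lookup : ∀ {R : Point → Point → Set} {A B} → Pointwise R A B → (same : SameOrderType A B) →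
                   ∀ i → R (lookup A i) (lookup B (sameOrderType-index same i))
pointwise-lookup (related ∷ _)  (_ ∷ _)    zero    = related
pointwise-lookup (_ ∷ relateds) (_ ∷ same) (suc i) = pointwise-lookup relateds same i

sameOrderType-agree : ∀ {A B} (same : SameOrderType A B) i j →
                      Agree (lookup A i) (lookup A j)
                            (lookup B (sameOrderType-index same i)) (lookup B (sameOrderType-index same j))
sameOrderType-agree (_ ∷ _)         zero    zero    = sameSide-refl , sameSide-refl
sameOrderType-agree (agrees ∷ same) zero    (suc j) = pointwise-lookup agrees same j
sameOrderType-agree (agrees ∷ same) (suc i) zero    = agree-swap (pointwise-lookup agrees same i)
sameOrderType-agree (_ ∷ same)      (suc i) (suc j) = sameOrderType-agree same i j

sameOrderType⇒orderEmbedding : ∀ {A B} → SameOrderType A B → OrderEmbedding A B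
sameOrderType⇒orderEmbedding same = record
  { index       = sameOrderType-index same
  ; preserves-X = λ i j → proj₁ (proj₁ (sameOrderType-agree same i j))
  ; preserves-Y = λ i j → proj₁ (proj₂ (sameOrderType-agree same i j))
  }

-- Plots of permutations

-- plot is defined with a pattern-matching lambda, which can only be reached through
-- an arbitrary labelling function with the same values.
module _ (label : ℕ × ℕ → Point) (label-spec : ∀ m n → label (m , n) ≡ (+ m , + n)) where

  labelled-length : ∀ (f : ℕ → ℕ) π → length (map label (zip (applyUpTo f (length π)) π)) ≡ length π
  labelled-length f []      = refl
  labelled-length f (_ ∷ π) = cong suc (labelled-length (f ∘ suc) π)

  labelled-lookup : ∀ (f : ℕ → ℕ) π i →
    lookup (map label (zip (applyUpTo f (length π)) π)) i ≡ (+ f (Fin.toℕ i) , + lookup π (Fin.cast (labelled-length f π) i))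
  labelled-lookup f (x ∷ π) zero    = label-spec (f 0) x
  labelled-lookup f (x ∷ π) (suc i) = labelled-lookup (f ∘ suc) π i

plot-length : ∀ π → length (plot π) ≡ length π
plot-length = labelled-length _ (λ _ _ → refl) id

plot-lookup : ∀ π i → lookup (plot π) i ≡ (+ Fin.toℕ i , + lookup π (Fin.cast (plot-length π) i))
plot-lookup = labelled-lookup _ (λ _ _ → refl) id

+<+⇔ : ∀ {m n} → + m ℤ.< + n ⇔ m ℕ.< n
+<+⇔ = mk⇔ ℤ.drop‿+<+ ℤ.+<+

plot-X : ∀ π i j → X (lookup (plot π) i) ℤ.< X (lookup (plot π) j) ⇔ Fin.toℕ i ℕ.< Fin.toℕ j
plot-X π i j rewrite plot-lookup π i | plot-lookup π j = +<+⇔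

plot-Y : ∀ π i j → Y (lookup (plot π) i) ℤ.< Y (lookup (plot π) j) ⇔
                   lookup π (Fin.cast (plot-length π) i) ℕ.< lookup π (Fin.cast (plot-length π) j)
plot-Y π i j rewrite plot-lookup π i | plot-lookup π j = +<+⇔

plotEmbedding⇒contains : ∀ π σ → OrderEmbedding (plot σ) (plot π) → Contains π σ
plotEmbedding⇒contains π σ e = τ , tabulate-lookup-⊆ π position position-increasing , same-length , τ-order
  where
  position : Fin (length (plot σ)) → Fin (length π)
  position = Fin.cast (plot-length π) ∘ index e

  position-increasing : Increasing position
  position-increasing {i} {j} i<j =
    subst₂ ℕ._<_ (sym (Fin.toℕ-cast _ (index e i))) (sym (Fin.toℕ-cast _ (index e j)))
      (Equivalence.to (⇔-trans (⇔-sym (plot-X σ i j)) (⇔-trans (preserves-X e i j) (plot-X π _ _))) i<j)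

  value-order : ∀ i j → lookup σ (Fin.cast (plot-length σ) i) ℕ.< lookup σ (Fin.cast (plot-length σ) j) ⇔
                        lookup π (position i) ℕ.< lookup π (position j)
  value-order i j = ⇔-trans (⇔-sym (plot-Y σ i j)) (⇔-trans (preserves-Y e i j) (plot-Y π _ _))

  τ : List ℕ
  τ = tabulate (lookup π ∘ position)

  same-length : length τ ≡ length σ
  same-length = trans (length-tabulate _) (plot-length σ)

  τ-order : ∀ i j → lookup τ i ℕ.< lookup τ j ⇔ lookup σ (Fin.cast same-length i) ℕ.< lookup σ (Fin.cast same-length j)
  τ-order i j
    rewrite lookup-tabulate′ (lookup π ∘ position) i | lookup-tabulate′ (lookup π ∘ position) j
          | sym (Fin.cast-trans (length-tabulate (lookup π ∘ position)) (plot-length σ) i)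
          | sym (Fin.cast-trans (length-tabulate (lookup π ∘ position)) (plot-length σ) j)
    = ⇔-sym (value-order _ _)

sameOrderType⇒contains : ∀ π σ {ps qs sub} → OrderIso (plot π) ps → sub ⊆ ps → SameOrderType qs sub →
                         OrderIso (plot σ) qs → Contains π σ
sameOrderType⇒contains π σ π≅ps sub⊆ps qs≈sub σ≅qs =
  plotEmbedding⇒contains π σ
    (orderEmbedding-trans (orderIso⇒orderEmbedding σ≅qs)
    (orderEmbedding-trans (sameOrderType⇒orderEmbedding qs≈sub)
    (orderEmbedding-trans (⊆⇒orderEmbedding sub⊆ps) (orderIso⇒orderEmbedding⁻¹ π≅ps))))

factor-contains : ∀ n {v w} → In𝒫 v → In𝒫 w → Factor v w → ∀ π σ {ps qs} → Construction w ps → Construction v qs →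
                  OrderIso (plot π) (drop n ps) → OrderIso (plot σ) (drop n qs) → Contains π σ
factor-contains n v∈𝒫 w∈𝒫 v-factor π σ w-construction v-construction π≅ps σ≅qs
  with factor-sameOrderType v∈𝒫 w∈𝒫 v-factor v-construction w-construction
... | sub , sub⊆ps , qs≈sub = sameOrderType⇒contains π σ π≅ps (drop⁺-⊆ n sub⊆ps) (sameOrderType-drop n qs≈sub) σ≅qs

proposition4p1 : (v w : Word) → In𝒫 v → In𝒫 w → Factor v w →
    ((π σ : List ℕ) → IsPsiCirc w π → IsPsiCirc v σ → Contains π σ)
    × ((π σ : List ℕ) → IsPsiBullet w π → IsPsiBullet v σ → Contains π σ)
proposition4p1 v w v∈𝒫 w∈𝒫 v-factor =
  (λ π σ (_ , _ , w-construction , π≅ps) (_ , _ , v-construction , σ≅qs) →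
     factor-contains 1 v∈𝒫 w∈𝒫 v-factor π σ w-construction v-construction π≅ps σ≅qs) ,
  (λ π σ (_ , _ , w-construction , π≅ps) (_ , _ , v-construction , σ≅qs) →
     factor-contains 0 v∈𝒫 w∈𝒫 v-factor π σ w-construction v-construction π≅ps σ≅qs)
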